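{- Fix a base $b\ge 2$ and a positive integer $M$. Then the set of $b$-ARH numbers having $M$ as an additive multiplier is finite.
   Context: For a positive integer $N$, $s_b(N)$ is the sum of the base-$b$ digits of $N$, and the reversal $N^R$ is the integer obtained by writing the base-$b$ digits of $N$ in reverse order. A positive integer $N$ is a $b$-ARH number if there exists a positive integer $M$ (called an additive multiplier of $N$) such that $N=Ms_b(N)+(Ms_b(N))^R$. -}

module Defs where

open import Data.Nat using (ℕ; zero; suc; _+_; _*_; _<_; _≤_; NonZero)
open import Data.Nat.DivMod using (_/_; _%_)
open import Data.List using (List; []; _∷_; reverse; foldr)
open import Data.Nat.ListAction using (sum)
open import Relation.Binary.PropositionalEquality using (_≡_)
open import Data.Product using (∃; _×_)

-- Base-b digits of n, least significant first; 0 has the empty digit list.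
-- The fuel argument is only for termination: with fuel ≥ n it is exhaustive
-- (each step divides by b ≥ 2).
digitsFuel : (b : ℕ) → .{{NonZero b}} → ℕ → ℕ → List ℕ
digitsFuel b zero    n       = []
digitsFuel b (suc f) zero    = []
digitsFuel b (suc f) (suc n) = (suc n % b) ∷ digitsFuel b f (suc n / b)

digits : (b : ℕ) → .{{NonZero b}} → ℕ → List ℕ
digits b n = digitsFuel b n n

fromDigits : ℕ → List ℕ → ℕ
fromDigits b = foldr (λ d acc → d + b * acc) 0

s : (b : ℕ) → .{{NonZero b}} → ℕ → ℕ
s b n = sum (digits b n)

rev : (b : ℕ) → .{{NonZero b}} → ℕ → ℕ
rev b n = fromDigits b (reverse (digits b n))

IsAdditiveMultiplier : (b : ℕ) → .{{NonZero b}} → ℕ → ℕ → Set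
IsAdditiveMultiplier b M N = 0 < N × N ≡ M * s b N + rev b (M * s b N)

module Submission where

-- Let N = x + x^R with x = M·s_b(N), and let L be the number of base-b
-- digits of N.  Every digit is < b, so s_b(N) ≤ b·L; a number and its
-- reversal have the same number of digits, so x^R < b^(digits of x) ≤ b·x.
-- Hence N ≤ (b+1)·x ≤ C·L with C = (b+1)·M·b: an ARH number grows at most
-- linearly in its digit count.  On the other hand N has L digits, so
-- 2^L ≤ b^L ≤ b·N ≤ K·L with K = b·C.  An exponential can only stay below a
-- linear function on a bounded range: 2^L ≤ K·L forces K·L ≤ (2K)², and so
-- N ≤ C·L ≤ K·L ≤ (2K)², a bound depending only on b and M.

open import Defs
open import Data.Nat using (ℕ; zero; suc; _+_; _*_; _^_; _<_; _≤_; _≤?_; NonZero; z≤n; s≤s)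
open import Data.Nat.Properties
open import Data.Nat.DivMod using (_/_; _%_; m%n<n; m/n*n≤m; m/n<m)
open import Data.Nat.ListAction using (sum)
open import Data.Nat.Tactic.RingSolver using (solve-∀)
open import Data.List using (List; []; _∷_; reverse; length)
open import Data.List.Properties using (length-reverse)
open import Data.List.Relation.Unary.All using (All; []; _∷_)
open import Data.List.Relation.Binary.Permutation.Propositional using (↭-sym)
open import Data.List.Relation.Binary.Permutation.Propositional.Properties using (All-resp-↭; ↭-reverse)
open import Data.Product using (∃; _,_)
open import Relation.Nullary using (yes; no)
open import Relation.Binary.PropositionalEquality using (_≡_; refl; sym; cong)

digitsFuel-< : ∀ b .{{_ : NonZero b}} f n → All (_< b) (digitsFuel b f n)
digitsFuel-< b zero    n       = []
digitsFuel-< b (suc f) zero    = []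
digitsFuel-< b (suc f) (suc n) = m%n<n (suc n) b ∷ digitsFuel-< b f (suc n / b)

fromDigits-< : ∀ b ds → All (_< b) ds → fromDigits b ds < b ^ length ds
fromDigits-< b []       []       = s≤s z≤n
fromDigits-< b (d ∷ ds) (d<b ∷ ds<b) = begin-strict
  d + b * fromDigits b ds    <⟨ +-monoˡ-< (b * fromDigits b ds) d<b ⟩
  b + b * fromDigits b ds    ≡⟨ sym (*-suc b _) ⟩
  b * suc (fromDigits b ds)  ≤⟨ *-monoʳ-≤ b (fromDigits-< b ds ds<b) ⟩
  b * b ^ length ds          ∎
  where open ≤-Reasoning

sum-≤ : ∀ b ds → All (_< b) ds → sum ds ≤ b * length ds
sum-≤ b []       []       = z≤n
sum-≤ b (d ∷ ds) (d<b ∷ ds<b) = begin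
  d + sum ds               ≤⟨ +-mono-≤ (<⇒≤ d<b) (sum-≤ b ds ds<b) ⟩
  b + b * length ds        ≡⟨ sym (*-suc b (length ds)) ⟩
  b * suc (length ds)      ∎
  where open ≤-Reasoning

digitsFuel-zero : ∀ b .{{_ : NonZero b}} f → digitsFuel b f 0 ≡ []
digitsFuel-zero b zero    = refl
digitsFuel-zero b (suc f) = refl

-- A positive n with ℓ base-b digits satisfies b^(ℓ-1) ≤ n, i.e. b^ℓ ≤ b·n
-- (provided the fuel suffices, f ≥ n, and b > 1 so that n / b < n).
digitsFuel-length : ∀ b .{{_ : NonZero b}} → 1 < b → ∀ f n → n ≤ f → 0 < n →
                    b ^ length (digitsFuel b f n) ≤ b * n
digitsFuel-length b 1<b (suc f) (suc n) (s≤s n≤f) _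
  with suc n / b | m/n<m (suc n) b 1<b | m/n*n≤m (suc n) b
... | zero  | _       | _ rewrite digitsFuel-zero b f = *-monoʳ-≤ b (s≤s z≤n)
... | suc q | q<n     | q*b≤n = *-monoʳ-≤ b (begin
  b ^ length (digitsFuel b f (suc q))  ≤⟨ digitsFuel-length b 1<b f (suc q)
                                            (≤-trans (<⇒≤pred q<n) n≤f) (s≤s z≤n) ⟩
  b * suc q                            ≡⟨ *-comm b (suc q) ⟩
  suc q * b                            ≤⟨ q*b≤n ⟩
  suc n                                ∎)
  where open ≤-Reasoning

digits-length : ∀ b .{{_ : NonZero b}} → 1 < b → ∀ n → 0 < n →
                b ^ length (digits b n) ≤ b * n
digits-length b 1<b n = digitsFuel-length b 1<b n n ≤-refl

s-≤ : ∀ b .{{_ : NonZero b}} n → s b n ≤ b * length (digits b n)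
s-≤ b n = sum-≤ b (digits b n) (digitsFuel-< b n n)

-- Reversal keeps the number of digits, hence rev x < b^ℓ ≤ b·x.
rev-≤ : ∀ b .{{_ : NonZero b}} → 1 < b → ∀ x → rev b x ≤ b * x
rev-≤ b 1<b zero    = z≤n
rev-≤ b 1<b (suc x) = begin
  fromDigits b (reverse ds)  ≤⟨ <⇒≤ (fromDigits-< b (reverse ds) (All-resp-↭ (↭-sym (↭-reverse ds)) (digitsFuel-< b (suc x) (suc x)))) ⟩
  b ^ length (reverse ds)    ≡⟨ cong (b ^_) (length-reverse ds) ⟩
  b ^ length ds              ≤⟨ digits-length b 1<b (suc x) (s≤s z≤n) ⟩
  b * suc x                  ∎
  where
  open ≤-Reasoning
  ds = digits b (suc x)

arh-linear : ∀ b .{{_ : NonZero b}} → 1 < b → ∀ M N → IsAdditiveMultiplier b M N →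
             N ≤ (suc b * (M * b)) * length (digits b N)
arh-linear b 1<b M N (_ , N≡) = begin
  N                                ≡⟨ N≡ ⟩
  x + rev b x                      ≤⟨ +-monoʳ-≤ x (rev-≤ b 1<b x) ⟩
  suc b * x                        ≤⟨ *-monoʳ-≤ (suc b) (*-monoʳ-≤ M (s-≤ b N)) ⟩
  suc b * (M * (b * L))            ≡⟨ reassociate b M L ⟩
  (suc b * (M * b)) * L            ∎
  where
  open ≤-Reasoning
  x = M * s b N
  L = length (digits b N)
  reassociate : ∀ c m l → suc c * (m * (c * l)) ≡ (suc c * (m * c)) * l
  reassociate = solve-∀

n<2^n : ∀ n → n < 2 ^ n
n<2^n zero    = s≤s z≤n
n<2^n (suc n) = +-mono-≤ (≤-trans (s≤s z≤n) (n<2^n n)) (≤-trans (n<2^n n) (m≤m+n (2 ^ n) 0))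

-- Linear growth is eventually beaten by 2^L: K·L ≤ 2^L + K².
-- (For L < K the product is below K²; beyond, each step adds K ≤ 2^L.)
linear-≤-exp : ∀ K L → K * L ≤ 2 ^ L + K * K
linear-≤-exp K zero rewrite *-zeroʳ K = z≤n
linear-≤-exp K (suc L) with K ≤? L
... | yes K≤L = begin
  K * suc L                  ≡⟨ *-suc K L ⟩
  K + K * L                  ≤⟨ +-mono-≤ (≤-trans K≤L (<⇒≤ (n<2^n L))) (linear-≤-exp K L) ⟩
  2 ^ L + (2 ^ L + K * K)    ≡⟨ sym (+-assoc (2 ^ L) (2 ^ L) (K * K)) ⟩
  2 ^ L + 2 ^ L + K * K      ≡⟨ cong (λ y → 2 ^ L + y + K * K) (sym (+-identityʳ (2 ^ L))) ⟩
  2 ^ suc L + K * K          ∎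
  where open ≤-Reasoning
... | no K≰L = ≤-trans (*-monoʳ-≤ K (≰⇒> K≰L)) (m≤n+m (K * K) (2 ^ suc L))

exp-≤-linear⇒bounded : ∀ K L → 2 ^ L ≤ K * L → K * L ≤ (2 * K) * (2 * K)
exp-≤-linear⇒bounded K L 2^L≤KL = +-cancelˡ-≤ (K * L) _ _ (begin
  K * L + K * L              ≡⟨ double K L ⟩
  (2 * K) * L                ≤⟨ linear-≤-exp (2 * K) L ⟩
  2 ^ L + (2 * K) * (2 * K)  ≤⟨ +-monoˡ-≤ _ 2^L≤KL ⟩
  K * L + (2 * K) * (2 * K)  ∎)
  where
  open ≤-Reasoning
  double : ∀ k l → k * l + k * l ≡ (2 * k) * l
  double = solve-∀

corollary36 : (b : ℕ) → .{{_ : NonZero b}} → 2 ≤ b → (M : ℕ) → 0 < M →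
              ∃ λ B → ∀ N → IsAdditiveMultiplier b M N → N ≤ B
corollary36 b 2≤b M _ = (2 * K) * (2 * K) , bound
  where
  C = suc b * (M * b)
  K = b * C
  bound : ∀ N → IsAdditiveMultiplier b M N → N ≤ (2 * K) * (2 * K)
  bound N arh@(0<N , _) = ≤-trans N≤CL (≤-trans CL≤KL (exp-≤-linear⇒bounded K L 2^L≤KL))
    where
    open ≤-Reasoning
    L = length (digits b N)
    N≤CL : N ≤ C * L
    N≤CL = arh-linear b 2≤b M N arh
    CL≤KL : C * L ≤ K * L
    CL≤KL = *-monoˡ-≤ L (m≤n*m C b)
    2^L≤KL : 2 ^ L ≤ K * L
    2^L≤KL = begin
      2 ^ L        ≤⟨ ^-monoˡ-≤ L 2≤b ⟩
      b ^ L        ≤⟨ digits-length b 2≤b N 0<N ⟩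
      b * N        ≤⟨ *-monoʳ-≤ b N≤CL ⟩
      b * (C * L)  ≡⟨ sym (*-assoc b C L) ⟩
      K * L        ∎
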